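{- For all integers $n,k\ge0$ and all $a,b,c_0,c_\infty\in\mathbb{C}$, \[b^kk!\,E_{n,k}(a,b;c_0,c_\infty)=\sum_{j=0}^k(-1)^{k-j}\binom kj(bn+c_0+c_\infty)^{\underline{k-j},b}(c_0+c_\infty)^{\overline j,b}(bj+c_0)^{\underline n,a},\] \[(c_0+c_\infty)^{\overline k,b}(bk+c_0)^{\underline n,a}=\sum_{j=0}^k\binom kj(bn+c_0+c_\infty)^{\overline{k-j},b}\,b^jj!\,E_{n,j}(a,b;c_0,c_\infty).\]
   Context: For complex parameters $(\alpha,\beta,\gamma;\alpha',\beta',\gamma')$, the GKP triangle is the unique array $T_{n,k}$, $0\le k\le n$ ($T_{n,k}=0$ if $k<0$ or $k>n$), with $T_{0,0}=1$ and $T_{n+1,k+1}=[\alpha n+\beta(k+1)+\gamma]T_{n,k+1}+[\alpha' n+\beta' k+\gamma']T_{n,k}$ for $n\ge0$, $k\ge-1$. The generalized Eulerian numbers $E_{n,k}(a,b;c_0,c_\infty)$ form the GKP triangle with parameters $(-a,b,c_0;\,a+b,-b,c_\infty)$, with $E_{n,k}=0$ for $k>n$. Generalized factorials: $(x)^{\overline m,b}=x(x+b)\cdots(x+(m-1)b)$, $(x)^{\underline m,b}=x(x-b)\cdots(x-(m-1)b)$, both $1$ when $m=0$. -}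

module Defs where

open import Level using (Level)
open import Algebra.Bundles using (CommutativeRing)
open import Data.Nat as ℕ using (ℕ; zero; suc; _∸_)
open import Data.Nat.Combinatorics using (_C_)
open import Data.Nat using (_!)

-- All notions are defined over an arbitrary commutative ring R
-- (the paper works over ℂ).
module GE {c ℓ : Level} (R : CommutativeRing c ℓ) where
  open CommutativeRing R hiding (zero)

  ι : ℕ → Carrier
  ι zero    = 0#
  ι (suc n) = 1# + ι n

  pow : Carrier → ℕ → Carrier
  pow x zero    = 1#
  pow x (suc m) = x * pow x m

  sgn : ℕ → Carrier
  sgn m = pow (- 1#) m

  rising : Carrier → ℕ → Carrier → Carrier
  rising x zero    b = 1#
  rising x (suc m) b = x * rising (x + b) m b

  falling : Carrier → ℕ → Carrier → Carrier
  falling x zero    b = 1#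
  falling x (suc m) b = x * falling (x - b) m b

  sumTo : ℕ → (ℕ → Carrier) → Carrier
  sumTo zero    f = f 0
  sumTo (suc k) f = sumTo k f + f (suc k)

  -- GKP triangle with parameters (α,β,γ;α',β',γ'), T n k for k ≥ 0
  -- (T n k = 0 for k > n is automatic; T n (-1) = 0 is used at k = 0).
  GKP : (α β γ α' β' γ' : Carrier) → ℕ → ℕ → Carrier
  GKP α β γ α' β' γ' zero    zero    = 1#
  GKP α β γ α' β' γ' zero    (suc k) = 0#
  GKP α β γ α' β' γ' (suc n) zero    =
    (α * ι n + β * ι 0 + γ) * GKP α β γ α' β' γ' n zero
  GKP α β γ α' β' γ' (suc n) (suc k) =
    (α * ι n + β * ι (suc k) + γ) * GKP α β γ α' β' γ' n (suc k)
    + (α' * ι n + β' * ι k + γ') * GKP α β γ α' β' γ' n k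

  E : (a b c₀ c∞ : Carrier) → ℕ → ℕ → Carrier
  E a b c₀ c∞ = GKP (- a) b c₀ (a + b) (- b) c∞

  binom : ℕ → ℕ → Carrier
  binom k j = ι (k C j)

  fact : ℕ → Carrier
  fact k = ι (k !)

-- Write F n k = b^k k! E n k, X n = b n + c₀ + c∞ and P n k = (c₀+c∞)^{\overline k,b} (bk+c₀)^{\underline n,a}.
-- The two identities say that F n and P n are binomial transforms of each other, with kernels
-- (-X n)^{\overline m,b} and (X n)^{\overline m,b}; by Vandermonde's identity for rising factorials
-- these kernels are mutually inverse. Both identities are proved by induction on n: at n = 0,
-- F 0 k is (0)^{\overline k,b} = (c₀ + c∞ - X 0)^{\overline k,b}, which Vandermonde expands. In the
-- step, the GKP recurrence of F and the recurrence P (n+1) k = (bk + c₀ - na) P n k are matched term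
-- by term; after the binomial absorption identities what remains are two polynomial identities
-- in the GKP weights.
module Submission where

open import Defs
open import Level using (Level)
open import Algebra.Bundles using (CommutativeRing)
open import Data.Nat as ℕ using (ℕ; zero; suc; _∸_; _≤_)
import Data.Nat.Properties as ℕ
open import Data.Nat.Combinatorics using (_C_; k>n⇒nCk≡0; nCk+nC[k+1]≡[n+1]C[k+1])
open import Data.Integer as ℤ using (ℤ; +_; -[1+_]; _⊖_)
import Data.Integer.Properties as ℤ
open import Data.Maybe using (Maybe; just; nothing)
open import Data.Product using (_×_; _,_)
open import Relation.Nullary using (yes; no)
open import Relation.Binary.PropositionalEquality as ≡ using (_≡_)
import Algebra.Solver.Ring
open import Algebra.Solver.Ring.AlmostCommutativeRing
  using (fromCommutativeRing; _-Raw-AlmostCommutative⟶_)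

-- Integer coefficients for the standard ring solver. The optimised multiple n · 1# is used so
-- that the constant con (+ 1) of an equation denotes 1# itself, not 1# + 0#.
module IntegerCoefficientSolver {c ℓ : Level} (R : CommutativeRing c ℓ) where
  open CommutativeRing R
  open import Algebra.Properties.Ring ring using (-0#≈0#; -‿involutive; -‿+-comm; -‿distribˡ-*; -‿distribʳ-*)
  open import Algebra.Properties.Semiring.Mult.TCOptimised semiring using (1+×; ×-homo-+; ×1-homo-*)
    renaming (_×_ to _·_)
  open import Algebra.Properties.CommutativeSemigroup +-commutativeSemigroup using (interchange)
  open import Relation.Binary.Reasoning.Setoid setoid

  private

    ⟦_⟧ℤ : ℤ → Carrier
    ⟦ + n ⟧ℤ      = n · 1#
    ⟦ -[1+ n ] ⟧ℤ = - (suc n · 1#)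

    ⟦-⟧ℤ : ∀ i → ⟦ ℤ.- i ⟧ℤ ≈ - ⟦ i ⟧ℤ
    ⟦-⟧ℤ (+ zero)  = sym -0#≈0#
    ⟦-⟧ℤ (+ suc n) = refl
    ⟦-⟧ℤ -[1+ n ]  = sym (-‿involutive _)

    ⟦⊖⟧ℤ : ∀ m n → ⟦ m ⊖ n ⟧ℤ ≈ m · 1# - n · 1#
    ⟦⊖⟧ℤ m       zero    = sym (trans (+-congˡ -0#≈0#) (+-identityʳ _))
    ⟦⊖⟧ℤ zero    (suc n) = sym (+-identityˡ _)
    ⟦⊖⟧ℤ (suc m) (suc n) = begin
      ⟦ suc m ⊖ suc n ⟧ℤ                  ≡⟨ ≡.cong ⟦_⟧ℤ (ℤ.[1+m]⊖[1+n]≡m⊖n m n) ⟩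
      ⟦ m ⊖ n ⟧ℤ                          ≈⟨ ⟦⊖⟧ℤ m n ⟩
      m · 1# - n · 1#                     ≈⟨ +-identityˡ _ ⟨
      0# + (m · 1# - n · 1#)              ≈⟨ +-congʳ (-‿inverseʳ 1#) ⟨
      (1# - 1#) + (m · 1# - n · 1#)       ≈⟨ interchange 1# (- 1#) (m · 1#) (- (n · 1#)) ⟩
      (1# + m · 1#) + (- 1# - n · 1#)     ≈⟨ +-cong (1+× m 1#) (trans (-‿cong (1+× n 1#)) (sym (-‿+-comm 1# (n · 1#)))) ⟨
      suc m · 1# - suc n · 1#             ∎

    ⟦+⟧ℤ : ∀ i j → ⟦ i ℤ.+ j ⟧ℤ ≈ ⟦ i ⟧ℤ + ⟦ j ⟧ℤ
    ⟦+⟧ℤ (+ m)    (+ n)    = ×-homo-+ 1# m n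
    ⟦+⟧ℤ (+ m)    -[1+ n ] = ⟦⊖⟧ℤ m (suc n)
    ⟦+⟧ℤ -[1+ m ] (+ n)    = trans (⟦⊖⟧ℤ n (suc m)) (+-comm _ _)
    ⟦+⟧ℤ -[1+ m ] -[1+ n ] = begin
      - (suc (suc (m ℕ.+ n)) · 1#)        ≡⟨ ≡.cong (λ k → - (k · 1#)) (ℕ.+-suc (suc m) n) ⟨
      - ((suc m ℕ.+ suc n) · 1#)          ≈⟨ -‿cong (×-homo-+ 1# (suc m) (suc n)) ⟩
      - (suc m · 1# + suc n · 1#)         ≈⟨ -‿+-comm _ _ ⟨
      - (suc m · 1#) - suc n · 1#         ∎

    ⟦+m*j⟧ℤ : ∀ m j → ⟦ + m ℤ.* j ⟧ℤ ≈ ⟦ + m ⟧ℤ * ⟦ j ⟧ℤ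
    ⟦+m*j⟧ℤ m (+ n)    = trans (reflexive (≡.cong ⟦_⟧ℤ (≡.sym (ℤ.pos-* m n)))) (×1-homo-* m n)
    ⟦+m*j⟧ℤ m -[1+ n ] = begin
      ⟦ + m ℤ.* ℤ.- (+ suc n) ⟧ℤ          ≡⟨ ≡.cong ⟦_⟧ℤ (ℤ.neg-distribʳ-* (+ m) (+ suc n)) ⟨
      ⟦ ℤ.- (+ m ℤ.* + suc n) ⟧ℤ          ≈⟨ ⟦-⟧ℤ (+ m ℤ.* + suc n) ⟩
      - ⟦ + m ℤ.* + suc n ⟧ℤ              ≈⟨ -‿cong (⟦+m*j⟧ℤ m (+ suc n)) ⟩
      - (m · 1# * suc n · 1#)             ≈⟨ -‿distribʳ-* _ _ ⟩
      m · 1# * - (suc n · 1#)             ∎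

    ⟦*⟧ℤ : ∀ i j → ⟦ i ℤ.* j ⟧ℤ ≈ ⟦ i ⟧ℤ * ⟦ j ⟧ℤ
    ⟦*⟧ℤ (+ m)    j = ⟦+m*j⟧ℤ m j
    ⟦*⟧ℤ -[1+ m ] j = begin
      ⟦ ℤ.- (+ suc m) ℤ.* j ⟧ℤ            ≡⟨ ≡.cong ⟦_⟧ℤ (ℤ.neg-distribˡ-* (+ suc m) j) ⟨
      ⟦ ℤ.- (+ suc m ℤ.* j) ⟧ℤ            ≈⟨ ⟦-⟧ℤ (+ suc m ℤ.* j) ⟩
      - ⟦ + suc m ℤ.* j ⟧ℤ                ≈⟨ -‿cong (⟦+m*j⟧ℤ (suc m) j) ⟩
      - (suc m · 1# * ⟦ j ⟧ℤ)             ≈⟨ -‿distribˡ-* _ _ ⟩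
      - (suc m · 1#) * ⟦ j ⟧ℤ             ∎

    ℤ⟶R : ℤ.+-*-rawRing -Raw-AlmostCommutative⟶ fromCommutativeRing R
    ℤ⟶R = record
      { ⟦_⟧ = ⟦_⟧ℤ ; +-homo = ⟦+⟧ℤ ; *-homo = ⟦*⟧ℤ ; -‿homo = ⟦-⟧ℤ
      ; 0-homo = refl ; 1-homo = refl }

    ⟦≟⟧ℤ : ∀ i j → Maybe (⟦ i ⟧ℤ ≈ ⟦ j ⟧ℤ)
    ⟦≟⟧ℤ i j with i ℤ.≟ j
    ... | yes i≡j = just (reflexive (≡.cong ⟦_⟧ℤ i≡j))
    ... | no  _   = nothing

  open Algebra.Solver.Ring _ _ ℤ⟶R ⟦≟⟧ℤ public using (solve; _:=_; _:+_; _:*_; _:-_; :-_; con)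

module NaturalNumberLemmas where
  open import Data.Nat
  open import Data.Nat.Properties
  open import Data.Nat.Combinatorics using (_C_; k>n⇒nCk≡0; nC1≡n; nCk+nC[k+1]≡[n+1]C[k+1])
  open import Relation.Nullary using (yes; no)
  open import Data.Sum using (inj₁; inj₂)
  open import Relation.Binary.PropositionalEquality
  open ≡-Reasoning

  1+[m+n]∸m≡1+n : ∀ m n → suc (m + n) ∸ m ≡ suc n
  1+[m+n]∸m≡1+n m n = trans (cong (_∸ m) (sym (+-suc m n))) (m+n∸m≡n m (suc n))

  ≤-cases : ∀ {p} {P : ℕ → ℕ → Set p} → (∀ j → P j j) → (∀ j m → P j (suc (j + m))) →
            ∀ {j k} → j ≤ k → P j k
  ≤-cases {P = P} diag below {j} j≤k with m≤n⇒m<n∨m≡n j≤k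
  ... | inj₂ refl       = diag j
  ... | inj₁ (s≤s j≤k′) = subst (λ k′ → P j (suc k′)) (m+[n∸m]≡n j≤k′) (below j _)

  -- For k > n the subtraction truncates, but then also j > n and n C j = 0.
  nCj*[1+k+[n∸k]]≡nCj*[1+n] : ∀ n j {k} → k ≤ j → (n C j) * (suc k + (n ∸ k)) ≡ (n C j) * suc n
  nCj*[1+k+[n∸k]]≡nCj*[1+n] n j {k} k≤j with k ≤? n
  ... | yes k≤n = cong (λ m → (n C j) * suc m) (m+[n∸m]≡n k≤n)
  ... | no  k≰n rewrite k>n⇒nCk≡0 (<-≤-trans (≰⇒> k≰n) k≤j) = refl

  [1+n]C[1+k]*m≡nCk*m+nC[1+k]*m : ∀ n k m → (suc n C suc k) * m ≡ (n C k) * m + (n C suc k) * m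
  [1+n]C[1+k]*m≡nCk*m+nC[1+k]*m n k m =
    trans (cong (_* m) (sym (nCk+nC[k+1]≡[n+1]C[k+1] n k))) (*-distribʳ-+ m (n C k) (n C suc k))

  mutual
    nC[1+k]*[1+k]≡nCk*[n∸k] : ∀ n k → (n C suc k) * suc k ≡ (n C k) * (n ∸ k)
    nC[1+k]*[1+k]≡nCk*[n∸k] zero    k = begin
      (0 C suc k) * suc k  ≡⟨ cong (_* suc k) (k>n⇒nCk≡0 {0} {suc k} z<s) ⟩
      0                    ≡⟨ *-zeroʳ (0 C k) ⟨
      (0 C k) * 0          ≡⟨ cong ((0 C k) *_) (0∸n≡0 k) ⟨
      (0 C k) * (0 ∸ k)    ∎
    nC[1+k]*[1+k]≡nCk*[n∸k] (suc n) zero    =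
      trans (*-identityʳ _) (trans (nC1≡n (suc n)) (sym (*-identityˡ (suc n))))
    nC[1+k]*[1+k]≡nCk*[n∸k] (suc n) (suc k) = begin
      (suc n C suc (suc k)) * suc (suc k)
        ≡⟨ [1+n]C[1+k]*m≡nCk*m+nC[1+k]*m n (suc k) (suc (suc k)) ⟩
      (n C suc k) * suc (suc k) + (n C suc (suc k)) * suc (suc k)
        ≡⟨ cong (_+_ ((n C suc k) * suc (suc k))) (nC[1+k]*[1+k]≡nCk*[n∸k] n (suc k)) ⟩
      (n C suc k) * suc (suc k) + (n C suc k) * (n ∸ suc k)
        ≡⟨ *-distribˡ-+ (n C suc k) (suc (suc k)) (n ∸ suc k) ⟨
      (n C suc k) * (suc (suc k) + (n ∸ suc k))
        ≡⟨ nCj*[1+k+[n∸k]]≡nCj*[1+n] n (suc k) ≤-refl ⟩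
      (n C suc k) * suc n
        ≡⟨ [1+n]C[1+k]*[n∸k]≡nC[1+k]*[1+n] n k ⟨
      (suc n C suc k) * (n ∸ k) ∎

    [1+n]C[1+k]*[n∸k]≡nC[1+k]*[1+n] : ∀ n k → (suc n C suc k) * (n ∸ k) ≡ (n C suc k) * suc n
    [1+n]C[1+k]*[n∸k]≡nC[1+k]*[1+n] n k = begin
      (suc n C suc k) * (n ∸ k)
        ≡⟨ [1+n]C[1+k]*m≡nCk*m+nC[1+k]*m n k (n ∸ k) ⟩
      (n C k) * (n ∸ k) + (n C suc k) * (n ∸ k)
        ≡⟨ cong (_+ (n C suc k) * (n ∸ k)) (nC[1+k]*[1+k]≡nCk*[n∸k] n k) ⟨
      (n C suc k) * suc k + (n C suc k) * (n ∸ k)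
        ≡⟨ *-distribˡ-+ (n C suc k) (suc k) (n ∸ k) ⟨
      (n C suc k) * (suc k + (n ∸ k))
        ≡⟨ nCj*[1+k+[n∸k]]≡nCj*[1+n] n (suc k) (n≤1+n k) ⟩
      (n C suc k) * suc n ∎

  [1+n]*nCk≡[1+n]Ck*[1+n∸k] : ∀ n k → suc n * (n C k) ≡ (suc n C k) * (suc n ∸ k)
  [1+n]*nCk≡[1+n]Ck*[1+n∸k] n zero    = trans (*-identityʳ (suc n)) (sym (*-identityˡ (suc n)))
  [1+n]*nCk≡[1+n]Ck*[1+n∸k] n (suc k) =
    trans (*-comm (suc n) (n C suc k)) (sym ([1+n]C[1+k]*[n∸k]≡nC[1+k]*[1+n] n k))

open NaturalNumberLemmas

module RingLemmas {c ℓ : Level} (R : CommutativeRing c ℓ) where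
  open CommutativeRing R hiding (zero)
  open GE R
  open IntegerCoefficientSolver R
  open import Algebra.Properties.CommutativeSemigroup +-commutativeSemigroup using (interchange)
  open import Relation.Binary.Reasoning.Setoid setoid

  ι-+ : ∀ m n → ι (m ℕ.+ n) ≈ ι m + ι n
  ι-+ zero    n = sym (+-identityˡ (ι n))
  ι-+ (suc m) n = trans (+-congˡ (ι-+ m n)) (sym (+-assoc 1# (ι m) (ι n)))

  ι-* : ∀ m n → ι (m ℕ.* n) ≈ ι m * ι n
  ι-* zero    n = sym (zeroˡ (ι n))
  ι-* (suc m) n = begin
    ι (n ℕ.+ m ℕ.* n)         ≈⟨ ι-+ n (m ℕ.* n) ⟩
    ι n + ι (m ℕ.* n)         ≈⟨ +-cong (sym (*-identityˡ (ι n))) (ι-* m n) ⟩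
    1# * ι n + ι m * ι n      ≈⟨ distribʳ (ι n) 1# (ι m) ⟨
    (1# + ι m) * ι n          ∎

  binom-zero : ∀ k → binom k 0 ≈ 1#
  binom-zero k = +-identityʳ 1#

  binom-suc-self : ∀ k → binom k (suc k) ≈ 0#
  binom-suc-self k = reflexive (≡.cong ι (k>n⇒nCk≡0 (ℕ.n<1+n k)))

  binom-pascal : ∀ k j → binom (suc k) (suc j) ≈ binom k j + binom k (suc j)
  binom-pascal k j = trans (reflexive (≡.cong ι (≡.sym (nCk+nC[k+1]≡[n+1]C[k+1] k j)))) (ι-+ (k C j) (k C suc j))

  binom-absorbˡ : ∀ n k → binom n (suc k) * ι (suc k) ≈ binom n k * ι (n ∸ k)
  binom-absorbˡ n k = begin
    binom n (suc k) * ι (suc k)  ≈⟨ ι-* (n C suc k) (suc k) ⟨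
    ι ((n C suc k) ℕ.* suc k)    ≡⟨ ≡.cong ι (nC[1+k]*[1+k]≡nCk*[n∸k] n k) ⟩
    ι ((n C k) ℕ.* (n ∸ k))      ≈⟨ ι-* (n C k) (n ∸ k) ⟩
    binom n k * ι (n ∸ k)        ∎

  binom-absorbʳ : ∀ n k → ι (suc n) * binom n k ≈ binom (suc n) k * ι (suc n ∸ k)
  binom-absorbʳ n k = begin
    ι (suc n) * binom n k            ≈⟨ ι-* (suc n) (n C k) ⟨
    ι (suc n ℕ.* (n C k))            ≡⟨ ≡.cong ι ([1+n]*nCk≡[1+n]Ck*[1+n∸k] n k) ⟩
    ι ((suc n C k) ℕ.* (suc n ∸ k))  ≈⟨ ι-* (suc n C k) (suc n ∸ k) ⟩
    binom (suc n) k * ι (suc n ∸ k)  ∎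

  sumTo-cong≤ : ∀ k {f g : ℕ → Carrier} → (∀ j → j ≤ k → f j ≈ g j) → sumTo k f ≈ sumTo k g
  sumTo-cong≤ zero    f≈g = f≈g 0 ℕ.z≤n
  sumTo-cong≤ (suc k) f≈g =
    +-cong (sumTo-cong≤ k (λ j j≤k → f≈g j (ℕ.m≤n⇒m≤1+n j≤k))) (f≈g (suc k) ℕ.≤-refl)

  sumTo-cong : ∀ k {f g : ℕ → Carrier} → (∀ j → f j ≈ g j) → sumTo k f ≈ sumTo k g
  sumTo-cong k f≈g = sumTo-cong≤ k (λ j _ → f≈g j)

  sumTo-cong-+ : ∀ k {f g : ℕ → Carrier} → (∀ j m → j ℕ.+ m ≡ k → f j ≈ g j) → sumTo k f ≈ sumTo k g
  sumTo-cong-+ k f≈g = sumTo-cong≤ k (λ j j≤k → f≈g j (k ∸ j) (ℕ.m+[n∸m]≡n j≤k))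

  sumTo-+ : ∀ k (f g : ℕ → Carrier) → sumTo k (λ j → f j + g j) ≈ sumTo k f + sumTo k g
  sumTo-+ zero    f g = refl
  sumTo-+ (suc k) f g = trans (+-congʳ (sumTo-+ k f g)) (interchange _ _ _ _)

  sumTo-*ˡ : ∀ k x (f : ℕ → Carrier) → sumTo k (λ j → x * f j) ≈ x * sumTo k f
  sumTo-*ˡ zero    x f = refl
  sumTo-*ˡ (suc k) x f = trans (+-congʳ (sumTo-*ˡ k x f)) (sym (distribˡ x _ _))

  sumTo-head : ∀ k (f : ℕ → Carrier) → (∀ j → f (suc j) ≈ 0#) → sumTo k f ≈ f 0
  sumTo-head zero    f f≈0 = refl
  sumTo-head (suc k) f f≈0 = trans (+-cong (sumTo-head k f f≈0) (f≈0 k)) (+-identityʳ _)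

  sumTo-shift : ∀ k (f g h : ℕ → Carrier) → h 0 ≈ f 0 → (∀ j → h (suc j) ≈ f (suc j) + g j) →
                sumTo k h + g k ≈ sumTo k (λ j → f j + g j)
  sumTo-shift zero    f g h h₀ hₛ = +-congʳ h₀
  sumTo-shift (suc k) f g h h₀ hₛ = begin
    (sumTo k h + h (suc k)) + g (suc k)               ≈⟨ +-congʳ (+-congˡ (hₛ k)) ⟩
    (sumTo k h + (f (suc k) + g k)) + g (suc k)       ≈⟨ solve 4 (λ s x y z → (s :+ (x :+ y)) :+ z := (s :+ y) :+ (x :+ z)) refl
                                                                (sumTo k h) (f (suc k)) (g k) (g (suc k)) ⟩
    (sumTo k h + g k) + (f (suc k) + g (suc k))       ≈⟨ +-congʳ (sumTo-shift k f g h h₀ hₛ) ⟩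
    sumTo k (λ j → f j + g j) + (f (suc k) + g (suc k)) ∎

  binom-sumTo-pascal : ∀ k (g : ℕ → Carrier) →
    sumTo (suc k) (λ j → binom (suc k) j * g j) ≈ sumTo k (λ j → binom k j * (g j + g (suc j)))
  binom-sumTo-pascal k g = begin
    sumTo (suc k) h
      ≡⟨⟩
    sumTo k h + binom (suc k) (suc k) * g (suc k)
      ≈⟨ +-congˡ (trans (*-congʳ (binom-pascal k k)) (distribʳ _ _ _)) ⟩
    sumTo k h + (binom k k * g (suc k) + binom k (suc k) * g (suc k))
      ≈⟨ +-congˡ (trans (+-congˡ (trans (*-congʳ (binom-suc-self k)) (zeroˡ _))) (+-identityʳ _)) ⟩
    sumTo k h + binom k k * g (suc k)
      ≈⟨ sumTo-shift k (λ j → binom k j * g j) (λ j → binom k j * g (suc j)) h refl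
           (λ j → trans (*-congʳ (binom-pascal k j)) (trans (distribʳ _ _ _) (+-comm _ _))) ⟩
    sumTo k (λ j → binom k j * g j + binom k j * g (suc j))
      ≈⟨ sumTo-cong k (λ j → sym (distribˡ _ _ _)) ⟩
    sumTo k (λ j → binom k j * (g j + g (suc j))) ∎
    where
    h : ℕ → Carrier
    h j = binom (suc k) j * g j

  rising-cong : ∀ m {x y} b → x ≈ y → rising x m b ≈ rising y m b
  rising-cong zero    b x≈y = refl
  rising-cong (suc m) b x≈y = *-cong x≈y (rising-cong m b (+-congʳ x≈y))

  rising-suc-last : ∀ m x b → rising x (suc m) b ≈ rising x m b * (x + ι m * b)
  rising-suc-last zero    x b = solve 2 (λ x b → x :* con (+ 1) := con (+ 1) :* (x :+ con (+ 0) :* b)) refl x b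
  rising-suc-last (suc m) x b = begin
    x * rising (x + b) (suc m) b                 ≈⟨ *-congˡ (rising-suc-last m (x + b) b) ⟩
    x * (rising (x + b) m b * (x + b + ι m * b)) ≈⟨ solve 4 (λ x r b i → x :* (r :* (x :+ b :+ i :* b)) := x :* r :* (x :+ (con (+ 1) :+ i) :* b))
                                                           refl x (rising (x + b) m b) b (ι m) ⟩
    x * rising (x + b) m b * (x + ι (suc m) * b) ∎

  falling-suc-last : ∀ m x b → falling x (suc m) b ≈ falling x m b * (x - ι m * b)
  falling-suc-last zero    x b = solve 2 (λ x b → x :* con (+ 1) := con (+ 1) :* (x :- con (+ 0) :* b)) refl x b
  falling-suc-last (suc m) x b = begin
    x * falling (x - b) (suc m) b                  ≈⟨ *-congˡ (falling-suc-last m (x - b) b) ⟩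
    x * (falling (x - b) m b * (x - b - ι m * b))  ≈⟨ solve 4 (λ x f b i → x :* (f :* (x :- b :- i :* b)) := x :* f :* (x :- (con (+ 1) :+ i) :* b))
                                                             refl x (falling (x - b) m b) b (ι m) ⟩
    x * falling (x - b) m b * (x - ι (suc m) * b)  ∎

  sgn*falling≈rising-neg : ∀ m x b → sgn m * falling x m b ≈ rising (- x) m b
  sgn*falling≈rising-neg zero    x b = *-identityʳ 1#
  sgn*falling≈rising-neg (suc m) x b = begin
    - 1# * sgn m * (x * falling (x - b) m b)  ≈⟨ solve 3 (λ s x f → :- con (+ 1) :* s :* (x :* f) := :- x :* (s :* f)) refl (sgn m) x _ ⟩
    - x * (sgn m * falling (x - b) m b)       ≈⟨ *-congˡ (sgn*falling≈rising-neg m (x - b) b) ⟩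
    - x * rising (- (x - b)) m b              ≈⟨ *-congˡ (rising-cong m b (solve 2 (λ x b → :- (x :- b) := :- x :+ b) refl x b)) ⟩
    - x * rising (- x + b) m b                ∎

  rising-vandermonde : ∀ k x y b →
    rising (x + y) k b ≈ sumTo k (λ j → binom k j * rising x (k ∸ j) b * rising y j b)
  rising-vandermonde zero    x y b = solve 0 (con (+ 1) := (con (+ 1) :+ con (+ 0)) :* con (+ 1) :* con (+ 1)) refl
  rising-vandermonde (suc k) x y b = begin
    rising (x + y) (suc k) b                                       ≈⟨ rising-suc-last k (x + y) b ⟩
    rising (x + y) k b * z                                         ≈⟨ *-comm _ z ⟩
    z * rising (x + y) k b                                         ≈⟨ *-congˡ (rising-vandermonde k x y b) ⟩
    z * sumTo k (λ j → binom k j * rising x (k ∸ j) b * rising y j b) ≈⟨ sumTo-*ˡ k z _ ⟨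
    sumTo k (λ j → z * (binom k j * rising x (k ∸ j) b * rising y j b)) ≈⟨ sumTo-cong-+ k step ⟩
    sumTo k (λ j → binom k j * (g j + g (suc j)))                  ≈⟨ binom-sumTo-pascal k g ⟨
    sumTo (suc k) (λ j → binom (suc k) j * g j)                    ≈⟨ sumTo-cong (suc k) (λ j → sym (*-assoc _ _ _)) ⟩
    sumTo (suc k) (λ j → binom (suc k) j * rising x (suc k ∸ j) b * rising y j b) ∎
    where
    z = x + y + ι k * b
    g : ℕ → Carrier
    g j = rising x (suc k ∸ j) b * rising y j b
    step : ∀ j m → j ℕ.+ m ≡ k → z * (binom k j * rising x (k ∸ j) b * rising y j b)
           ≈ binom k j * (rising x (suc k ∸ j) b * rising y j b + rising x (k ∸ j) b * rising y (suc j) b)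
    step j m ≡.refl = begin
      z * (binom k j * rising x (k ∸ j) b * rising y j b)
        ≡⟨ ≡.cong (λ d → z * (binom k j * rising x d b * rising y j b)) (ℕ.m+n∸m≡n j m) ⟩
      (x + y + ι (j ℕ.+ m) * b) * (binom k j * rising x m b * rising y j b)
        ≈⟨ *-congʳ (+-congˡ (*-congʳ (ι-+ j m))) ⟩
      (x + y + (ι j + ι m) * b) * (binom k j * rising x m b * rising y j b)
        ≈⟨ solve 8 (λ x y i i′ b c r s → (x :+ y :+ (i :+ i′) :* b) :* (c :* r :* s)
                      := c :* (r :* (x :+ i′ :* b) :* s :+ r :* (s :* (y :+ i :* b))))
                   refl x y (ι j) (ι m) b (binom k j) (rising x m b) (rising y j b) ⟩
      binom k j * (rising x m b * (x + ι m * b) * rising y j b + rising x m b * (rising y j b * (y + ι j * b)))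
        ≈⟨ *-congˡ (+-cong (*-congʳ (rising-suc-last m x b)) (*-congˡ (rising-suc-last j y b))) ⟨
      binom k j * (rising x (suc m) b * rising y j b + rising x m b * rising y (suc j) b)
        ≡⟨ ≡.cong₂ (λ d d′ → binom k j * (rising x d b * rising y j b + rising x d′ b * rising y (suc j) b))
                   (1+[m+n]∸m≡1+n j m) (ℕ.m+n∸m≡n j m) ⟨
      binom k j * (rising x (suc k ∸ j) b * rising y j b + rising x (k ∸ j) b * rising y (suc j) b) ∎

module EulerianIdentities {c ℓ : Level} (R : CommutativeRing c ℓ) (a b c₀ c∞ : CommutativeRing.Carrier R) where
  open CommutativeRing R hiding (zero)
  open GE R
  open IntegerCoefficientSolver R
  open RingLemmas R
  open import Relation.Binary.Reasoning.Setoid setoid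

  X : ℕ → Carrier
  X n = b * ι n + c₀ + c∞

  -- The weights α n + β k + γ and α′ n + β′ k + γ′ of the GKP recurrence defining E.
  vertical : ℕ → ℕ → Carrier
  vertical n k = - a * ι n + b * ι k + c₀

  diagonal : ℕ → ℕ → Carrier
  diagonal n k = (a + b) * ι n + - b * ι k + c∞

  X-suc : ∀ n → X n + b ≈ X (suc n)
  X-suc n = solve 4 (λ b n c₀ c∞ → b :* n :+ c₀ :+ c∞ :+ b := b :* (con (+ 1) :+ n) :+ c₀ :+ c∞) refl b (ι n) c₀ c∞

  -X-suc : ∀ n → - X (suc n) + b ≈ - X n
  -X-suc n = solve 4 (λ b n c₀ c∞ → :- (b :* (con (+ 1) :+ n) :+ c₀ :+ c∞) :+ b := :- (b :* n :+ c₀ :+ c∞))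
               refl b (ι n) c₀ c∞

  scaledE : ℕ → ℕ → Carrier
  scaledE n k = pow b k * fact k * E a b c₀ c∞ n k

  P : ℕ → ℕ → Carrier
  P n k = rising (c₀ + c∞) k b * falling (b * ι k + c₀) n a

  scaledE-zero-zero : scaledE 0 0 ≈ 1#
  scaledE-zero-zero = solve 0 (con (+ 1) :* (con (+ 1) :+ con (+ 0)) :* con (+ 1) := con (+ 1)) refl

  scaledE-zero-suc : ∀ k → scaledE 0 (suc k) ≈ 0#
  scaledE-zero-suc k = zeroʳ _

  scaledE-suc-zero : ∀ n → scaledE (suc n) 0 ≈ vertical n 0 * scaledE n 0
  scaledE-suc-zero n = solve 4 (λ p f v e → p :* f :* (v :* e) := v :* (p :* f :* e)) refl _ _ _ _

  scaledE-suc-suc : ∀ n k → scaledE (suc n) (suc k) ≈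
    vertical n (suc k) * scaledE n (suc k) + diagonal n k * (b * ι (suc k)) * scaledE n k
  scaledE-suc-suc n k = begin
    b * pow b k * fact (suc k) * (v * e₁ + d * e₀)
      ≈⟨ *-congʳ (*-congˡ (ι-* (suc k) (k ℕ.!))) ⟩
    b * pow b k * (ι (suc k) * fact k) * (v * e₁ + d * e₀)
      ≈⟨ solve 8 (λ b p i f v e₁ d e₀ → b :* p :* (i :* f) :* (v :* e₁ :+ d :* e₀)
                    := v :* (b :* p :* (i :* f) :* e₁) :+ d :* (b :* i) :* (p :* f :* e₀))
                 refl b (pow b k) (ι (suc k)) (fact k) v e₁ d e₀ ⟩
    v * (b * pow b k * (ι (suc k) * fact k) * e₁) + d * (b * ι (suc k)) * scaledE n k
      ≈⟨ +-congʳ (*-congˡ (*-congʳ (*-congˡ (ι-* (suc k) (k ℕ.!))))) ⟨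
    v * scaledE n (suc k) + d * (b * ι (suc k)) * scaledE n k ∎
    where
    v = vertical n (suc k)
    d = diagonal n k
    e₁ = E a b c₀ c∞ n (suc k)
    e₀ = E a b c₀ c∞ n k

  P-suc : ∀ n k → P (suc n) k ≈ vertical n k * P n k
  P-suc n k = begin
    rising (c₀ + c∞) k b * falling (b * ι k + c₀) (suc n) a
      ≈⟨ *-congˡ (falling-suc-last n (b * ι k + c₀) a) ⟩
    rising (c₀ + c∞) k b * (falling (b * ι k + c₀) n a * (b * ι k + c₀ - ι n * a))
      ≈⟨ solve 7 (λ r f b i c₀ n a → r :* (f :* (b :* i :+ c₀ :- n :* a)) := (:- a :* n :+ b :* i :+ c₀) :* (r :* f))
                 refl (rising (c₀ + c∞) k b) (falling (b * ι k + c₀) n a) b (ι k) c₀ (ι n) a ⟩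
    vertical n k * P n k ∎

  weights-explicit : ∀ n j m →
    vertical n (suc (j ℕ.+ m)) * (- X n + ι m * b) + ι (suc m) * (diagonal n (j ℕ.+ m) * b)
      ≈ - X (suc n) * vertical n j
  weights-explicit n j m = begin
    vertical n (suc (j ℕ.+ m)) * (- X n + ι m * b) + ι (suc m) * (diagonal n (j ℕ.+ m) * b)
      ≈⟨ +-cong (*-congʳ (+-congʳ (+-congˡ (*-congˡ (+-congˡ (ι-+ j m))))))
                (*-congˡ (*-congʳ (+-congʳ (+-congˡ (*-congˡ (ι-+ j m)))))) ⟩
    (- a * ι n + b * (1# + (ι j + ι m)) + c₀) * (- X n + ι m * b)
      + (1# + ι m) * (((a + b) * ι n + - b * (ι j + ι m) + c∞) * b)
      ≈⟨ solve 7 (λ a b c₀ c∞ n j m →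
            (:- a :* n :+ b :* (con (+ 1) :+ (j :+ m)) :+ c₀) :* (:- (b :* n :+ c₀ :+ c∞) :+ m :* b)
              :+ (con (+ 1) :+ m) :* (((a :+ b) :* n :+ :- b :* (j :+ m) :+ c∞) :* b)
            := :- (b :* (con (+ 1) :+ n) :+ c₀ :+ c∞) :* (:- a :* n :+ b :* j :+ c₀))
         refl a b c₀ c∞ (ι n) (ι j) (ι m) ⟩
    - X (suc n) * vertical n j ∎

  weights-inverse : ∀ n j m →
    vertical n j * (X (suc n) + ι m * b) + ι (suc m) * (diagonal n j * b)
      ≈ vertical n (suc (j ℕ.+ m)) * X n
  weights-inverse n j m = begin
    vertical n j * (X (suc n) + ι m * b) + ι (suc m) * (diagonal n j * b)
      ≈⟨ solve 7 (λ a b c₀ c∞ n j m →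
            (:- a :* n :+ b :* j :+ c₀) :* (b :* (con (+ 1) :+ n) :+ c₀ :+ c∞ :+ m :* b)
              :+ (con (+ 1) :+ m) :* (((a :+ b) :* n :+ :- b :* j :+ c∞) :* b)
            := (:- a :* n :+ b :* (con (+ 1) :+ (j :+ m)) :+ c₀) :* (b :* n :+ c₀ :+ c∞))
         refl a b c₀ c∞ (ι n) (ι j) (ι m) ⟩
    (- a * ι n + b * (1# + (ι j + ι m)) + c₀) * X n
      ≈⟨ *-congʳ (+-congʳ (+-congˡ (*-congˡ (+-congˡ (ι-+ j m))))) ⟨
    vertical n (suc (j ℕ.+ m)) * X n ∎

  explicitTerm : ℕ → ℕ → ℕ → Carrier
  explicitTerm n k j = binom k j * rising (- X n) (k ∸ j) b * P n j

  explicitTerm-above : ∀ n k → explicitTerm n k (suc k) ≈ 0#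
  explicitTerm-above n k = trans (*-congʳ (*-congʳ (binom-suc-self k))) (trans (*-congʳ (zeroˡ _)) (zeroˡ _))

  explicitTerm-diag : ∀ n k → vertical n k * explicitTerm n k k ≈ explicitTerm (suc n) k k
  explicitTerm-diag n k = begin
    vertical n k * (binom k k * rising (- X n) (k ∸ k) b * P n k)
      ≡⟨ ≡.cong (λ d → vertical n k * (binom k k * rising (- X n) d b * P n k)) (ℕ.n∸n≡0 k) ⟩
    vertical n k * (binom k k * 1# * P n k)
      ≈⟨ solve 3 (λ v c p → v :* (c :* p) := c :* (v :* p)) refl (vertical n k) (binom k k * 1#) (P n k) ⟩
    binom k k * 1# * (vertical n k * P n k)
      ≈⟨ *-congˡ (P-suc n k) ⟨
    binom k k * 1# * P (suc n) k
      ≡⟨ ≡.cong (λ d → binom k k * rising (- X (suc n)) d b * P (suc n) k) (ℕ.n∸n≡0 k) ⟨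
    explicitTerm (suc n) k k ∎

  explicitTerm-step : ∀ n k j m → j ℕ.+ m ≡ k →
    vertical n (suc k) * explicitTerm n (suc k) j + diagonal n k * (b * ι (suc k)) * explicitTerm n k j
      ≈ explicitTerm (suc n) (suc k) j
  explicitTerm-step n k j m ≡.refl = begin
    v * (C₁ * rising (- X n) (suc k ∸ j) b * p) + d * (b * ι (suc k)) * (C₀ * rising (- X n) (k ∸ j) b * p)
      ≡⟨ ≡.cong₂ (λ e e′ → v * (C₁ * rising (- X n) e b * p) + d * (b * ι (suc k)) * (C₀ * rising (- X n) e′ b * p))
                 (1+[m+n]∸m≡1+n j m) (ℕ.m+n∸m≡n j m) ⟩
    v * (C₁ * rising (- X n) (suc m) b * p) + d * (b * ι (suc k)) * (C₀ * r * p)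
      ≈⟨ +-cong (*-congˡ (*-congʳ (*-congˡ (rising-suc-last m (- X n) b))))
                (solve 6 (λ d b i c r p → d :* (b :* i) :* (c :* r :* p) := i :* c :* (d :* b :* r :* p))
                         refl d b (ι (suc k)) C₀ r p) ⟩
    v * (C₁ * (r * w) * p) + ι (suc k) * C₀ * (d * b * r * p)
      ≈⟨ +-congˡ (*-congʳ (binom-absorbʳ k j)) ⟩
    v * (C₁ * (r * w) * p) + C₁ * ι (suc k ∸ j) * (d * b * r * p)
      ≡⟨ ≡.cong (λ e → v * (C₁ * (r * w) * p) + C₁ * ι e * (d * b * r * p)) (1+[m+n]∸m≡1+n j m) ⟩
    v * (C₁ * (r * w) * p) + C₁ * ι (suc m) * (d * b * r * p)
      ≈⟨ solve 8 (λ v c r w p i d b → v :* (c :* (r :* w) :* p) :+ c :* i :* (d :* b :* r :* p)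
                    := c :* r :* p :* (v :* w :+ i :* (d :* b)))
                 refl v C₁ r w p (ι (suc m)) d b ⟩
    C₁ * r * p * (v * w + ι (suc m) * (d * b))
      ≈⟨ *-congˡ (weights-explicit n j m) ⟩
    C₁ * r * p * (- X (suc n) * vertical n j)
      ≈⟨ solve 5 (λ c r p x v → c :* r :* p :* (x :* v) := c :* (x :* r) :* (v :* p))
                 refl C₁ r p (- X (suc n)) (vertical n j) ⟩
    C₁ * (- X (suc n) * r) * (vertical n j * p)
      ≈⟨ *-cong (*-congˡ (*-congˡ (rising-cong m b (-X-suc n)))) (P-suc n j) ⟨
    C₁ * rising (- X (suc n)) (suc m) b * P (suc n) j
      ≡⟨ ≡.cong (λ e → C₁ * rising (- X (suc n)) e b * P (suc n) j) (1+[m+n]∸m≡1+n j m) ⟨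
    explicitTerm (suc n) (suc k) j ∎
    where
    v = vertical n (suc k)
    d = diagonal n k
    C₀ = binom k j
    C₁ = binom (suc k) j
    p = P n j
    r = rising (- X n) m b
    w = - X n + ι m * b

  scaledE-zero : ∀ k → scaledE 0 k ≈ rising 0# k b
  scaledE-zero zero    = scaledE-zero-zero
  scaledE-zero (suc k) = trans (scaledE-zero-suc k) (sym (zeroˡ _))

  explicit-formula-rising : ∀ n k → scaledE n k ≈ sumTo k (explicitTerm n k)
  explicit-formula-rising zero k = begin
    scaledE 0 k                                  ≈⟨ scaledE-zero k ⟩
    rising 0# k b                                ≈⟨ rising-cong k b X₀-cancel ⟩
    rising (- X 0 + (c₀ + c∞)) k b               ≈⟨ rising-vandermonde k (- X 0) (c₀ + c∞) b ⟩
    sumTo k (λ j → binom k j * rising (- X 0) (k ∸ j) b * rising (c₀ + c∞) j b)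
                                                 ≈⟨ sumTo-cong k (λ j → *-congˡ (*-identityʳ _)) ⟨
    sumTo k (explicitTerm 0 k)                   ∎
    where
    X₀-cancel : 0# ≈ - X 0 + (c₀ + c∞)
    X₀-cancel = solve 3 (λ b c₀ c∞ → con (+ 0) := :- (b :* con (+ 0) :+ c₀ :+ c∞) :+ (c₀ :+ c∞)) refl b c₀ c∞
  explicit-formula-rising (suc n) zero = begin
    scaledE (suc n) 0                  ≈⟨ scaledE-suc-zero n ⟩
    vertical n 0 * scaledE n 0         ≈⟨ *-congˡ (explicit-formula-rising n 0) ⟩
    vertical n 0 * explicitTerm n 0 0  ≈⟨ explicitTerm-diag n 0 ⟩
    explicitTerm (suc n) 0 0           ∎
  explicit-formula-rising (suc n) (suc k) = begin
    scaledE (suc n) (suc k)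
      ≈⟨ scaledE-suc-suc n k ⟩
    v * scaledE n (suc k) + q * scaledE n k
      ≈⟨ +-cong (*-congˡ (explicit-formula-rising n (suc k))) (*-congˡ (explicit-formula-rising n k)) ⟩
    v * sumTo (suc k) (explicitTerm n (suc k)) + q * sumTo k (explicitTerm n k)
      ≈⟨ +-congˡ (*-congˡ (trans (+-congˡ (explicitTerm-above n k)) (+-identityʳ _))) ⟨
    v * sumTo (suc k) (explicitTerm n (suc k)) + q * sumTo (suc k) (explicitTerm n k)
      ≈⟨ +-cong (sumTo-*ˡ (suc k) v _) (sumTo-*ˡ (suc k) q _) ⟨
    sumTo (suc k) (λ j → v * explicitTerm n (suc k) j) + sumTo (suc k) (λ j → q * explicitTerm n k j)
      ≈⟨ sumTo-+ (suc k) _ _ ⟨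
    sumTo (suc k) (λ j → v * explicitTerm n (suc k) j + q * explicitTerm n k j)
      ≈⟨ +-cong (sumTo-cong-+ k (explicitTerm-step n k)) last ⟩
    sumTo (suc k) (explicitTerm (suc n) (suc k)) ∎
    where
    v = vertical n (suc k)
    q = diagonal n k * (b * ι (suc k))
    last : v * explicitTerm n (suc k) (suc k) + q * explicitTerm n k (suc k) ≈ explicitTerm (suc n) (suc k) (suc k)
    last = trans (+-cong (explicitTerm-diag n (suc k)) (trans (*-congˡ (explicitTerm-above n k)) (zeroʳ q)))
                 (+-identityʳ _)

  inverseCoeff : ℕ → ℕ → ℕ → Carrier
  inverseCoeff n k j = binom k j * rising (X n) (k ∸ j) b

  inverseCoeff-diag : ∀ n j → vertical n j * inverseCoeff n j j ≈
    inverseCoeff (suc n) j j * vertical n j + inverseCoeff (suc n) j (suc j) * (diagonal n j * (b * ι (suc j)))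
  inverseCoeff-diag n j = begin
    vertical n j * (binom j j * rising (X n) (j ∸ j) b)
      ≡⟨ ≡.cong (λ d → vertical n j * (binom j j * rising (X n) d b)) (ℕ.n∸n≡0 j) ⟩
    vertical n j * (binom j j * 1#)
      ≈⟨ *-comm _ _ ⟩
    binom j j * 1# * vertical n j
      ≈⟨ +-identityʳ _ ⟨
    binom j j * 1# * vertical n j + 0#
      ≈⟨ +-congˡ (trans (*-congʳ (*-congʳ (binom-suc-self j))) (trans (*-congʳ (zeroˡ _)) (zeroˡ _))) ⟨
    binom j j * 1# * vertical n j + inverseCoeff (suc n) j (suc j) * (diagonal n j * (b * ι (suc j)))
      ≡⟨ ≡.cong (λ d → binom j j * rising (X (suc n)) d b * vertical n j + inverseCoeff (suc n) j (suc j) * (diagonal n j * (b * ι (suc j))))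
                (ℕ.n∸n≡0 j) ⟨
    inverseCoeff (suc n) j j * vertical n j + inverseCoeff (suc n) j (suc j) * (diagonal n j * (b * ι (suc j))) ∎

  inverseCoeff-below : ∀ n j m → let k = suc (j ℕ.+ m) in vertical n k * inverseCoeff n k j ≈
    inverseCoeff (suc n) k j * vertical n j + inverseCoeff (suc n) k (suc j) * (diagonal n j * (b * ι (suc j)))
  inverseCoeff-below n j m = begin
    vertical n k * (C₀ * rising (X n) (k ∸ j) b)
      ≡⟨ ≡.cong (λ e → vertical n k * (C₀ * rising (X n) e b)) (1+[m+n]∸m≡1+n j m) ⟩
    vertical n k * (C₀ * (X n * rising (X n + b) m b))
      ≈⟨ *-congˡ (*-congˡ (*-congˡ (rising-cong m b (X-suc n)))) ⟩
    vertical n k * (C₀ * (X n * r))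
      ≈⟨ solve 4 (λ v c x r → v :* (c :* (x :* r)) := c :* r :* (v :* x)) refl (vertical n k) C₀ (X n) r ⟩
    C₀ * r * (vertical n k * X n)
      ≈⟨ *-congˡ (weights-inverse n j m) ⟨
    C₀ * r * (vertical n j * (X (suc n) + ι m * b) + ι (suc m) * (diagonal n j * b))
      ≈⟨ solve 7 (λ c r v w i d b → c :* r :* (v :* w :+ i :* (d :* b)) := c :* (r :* w) :* v :+ c :* i :* (r :* (d :* b)))
                 refl C₀ r (vertical n j) (X (suc n) + ι m * b) (ι (suc m)) (diagonal n j) b ⟩
    C₀ * (r * (X (suc n) + ι m * b)) * vertical n j + C₀ * ι (suc m) * (r * (diagonal n j * b))
      ≡⟨ ≡.cong (λ e → C₀ * (r * (X (suc n) + ι m * b)) * vertical n j + C₀ * ι e * (r * (diagonal n j * b))) (1+[m+n]∸m≡1+n j m) ⟨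
    C₀ * (r * (X (suc n) + ι m * b)) * vertical n j + C₀ * ι (k ∸ j) * (r * (diagonal n j * b))
      ≈⟨ +-cong (*-congʳ (*-congˡ (rising-suc-last m (X (suc n)) b))) (*-congʳ (binom-absorbˡ k j)) ⟨
    C₀ * rising (X (suc n)) (suc m) b * vertical n j + C₁ * ι (suc j) * (r * (diagonal n j * b))
      ≈⟨ +-congˡ (solve 5 (λ c i r d b → c :* i :* (r :* (d :* b)) := c :* r :* (d :* (b :* i))) refl C₁ (ι (suc j)) r (diagonal n j) b) ⟩
    C₀ * rising (X (suc n)) (suc m) b * vertical n j + C₁ * r * (diagonal n j * (b * ι (suc j)))
      ≡⟨ ≡.cong₂ (λ e e′ → C₀ * rising (X (suc n)) e b * vertical n j + C₁ * rising (X (suc n)) e′ b * (diagonal n j * (b * ι (suc j))))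
                 (1+[m+n]∸m≡1+n j m) (ℕ.m+n∸m≡n j m) ⟨
    inverseCoeff (suc n) k j * vertical n j + inverseCoeff (suc n) k (suc j) * (diagonal n j * (b * ι (suc j))) ∎
    where
    k = suc (j ℕ.+ m)
    C₀ = binom k j
    C₁ = binom k (suc j)
    r = rising (X (suc n)) m b

  inverseCoeff-step : ∀ n {j k} → j ≤ k → vertical n k * inverseCoeff n k j ≈
    inverseCoeff (suc n) k j * vertical n j + inverseCoeff (suc n) k (suc j) * (diagonal n j * (b * ι (suc j)))
  inverseCoeff-step n = ≤-cases (inverseCoeff-diag n) (inverseCoeff-below n)

  inversion-formula : ∀ n k → P n k ≈ sumTo k (λ j → inverseCoeff n k j * scaledE n j)
  inversion-formula zero k = begin
    rising (c₀ + c∞) k b * 1#                 ≈⟨ *-identityʳ _ ⟩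
    rising (c₀ + c∞) k b                      ≈⟨ rising-cong k b X₀≈c ⟨
    rising (X 0) k b                          ≈⟨ trans (*-cong (*-congʳ (binom-zero k)) scaledE-zero-zero)
                                                       (trans (*-identityʳ _) (*-identityˡ _)) ⟨
    inverseCoeff 0 k 0 * scaledE 0 0          ≈⟨ sumTo-head k _ (λ j → trans (*-congˡ (scaledE-zero-suc j)) (zeroʳ _)) ⟨
    sumTo k (λ j → inverseCoeff 0 k j * scaledE 0 j) ∎
    where
    X₀≈c : X 0 ≈ c₀ + c∞
    X₀≈c = solve 3 (λ b c₀ c∞ → b :* con (+ 0) :+ c₀ :+ c∞ := c₀ :+ c∞) refl b c₀ c∞
  inversion-formula (suc n) k = begin
    P (suc n) k
      ≈⟨ P-suc n k ⟩
    vertical n k * P n k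
      ≈⟨ *-congˡ (inversion-formula n k) ⟩
    vertical n k * sumTo k (λ j → inverseCoeff n k j * scaledE n j)
      ≈⟨ sumTo-*ˡ k _ _ ⟨
    sumTo k (λ j → vertical n k * (inverseCoeff n k j * scaledE n j))
      ≈⟨ sumTo-cong≤ k (λ j j≤k → trans (sym (*-assoc _ _ _)) (*-congʳ (inverseCoeff-step n j≤k))) ⟩
    sumTo k (λ j → (u j * vertical n j + u (suc j) * q j) * scaledE n j)
      ≈⟨ sumTo-cong k (λ j → distribʳ _ _ _) ⟩
    sumTo k (λ j → u j * vertical n j * scaledE n j + u (suc j) * q j * scaledE n j)
      ≈⟨ sumTo-shift k (λ j → u j * vertical n j * scaledE n j) (λ j → u (suc j) * q j * scaledE n j)
                       (λ j → u j * scaledE (suc n) j) h₀ hₛ ⟨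
    sumTo k (λ j → u j * scaledE (suc n) j) + u (suc k) * q k * scaledE n k
      ≈⟨ +-congˡ (trans (*-congʳ (*-congʳ (*-congʳ (binom-suc-self k))))
                        (trans (*-congʳ (trans (*-congʳ (zeroˡ _)) (zeroˡ _))) (zeroˡ _))) ⟩
    sumTo k (λ j → u j * scaledE (suc n) j) + 0#
      ≈⟨ +-identityʳ _ ⟩
    sumTo k (λ j → u j * scaledE (suc n) j) ∎
    where
    u = inverseCoeff (suc n) k
    q : ℕ → Carrier
    q j = diagonal n j * (b * ι (suc j))
    h₀ : u 0 * scaledE (suc n) 0 ≈ u 0 * vertical n 0 * scaledE n 0
    h₀ = trans (*-congˡ (scaledE-suc-zero n)) (sym (*-assoc _ _ _))
    hₛ : ∀ j → u (suc j) * scaledE (suc n) (suc j) ≈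
               u (suc j) * vertical n (suc j) * scaledE n (suc j) + u (suc j) * q j * scaledE n j
    hₛ j = trans (*-congˡ (scaledE-suc-suc n j))
                 (trans (distribˡ _ _ _) (+-cong (sym (*-assoc _ _ _)) (sym (*-assoc _ _ _))))

  explicit-formula : ∀ n k → scaledE n k ≈ sumTo k (λ j → sgn (k ∸ j) * binom k j * falling (X n) (k ∸ j) b
                                                         * rising (c₀ + c∞) j b * falling (b * ι j + c₀) n a)
  explicit-formula n k = trans (explicit-formula-rising n k) (sumTo-cong k signed)
    where
    signed : ∀ j → explicitTerm n k j ≈
      sgn (k ∸ j) * binom k j * falling (X n) (k ∸ j) b * rising (c₀ + c∞) j b * falling (b * ι j + c₀) n a
    signed j = trans (*-congʳ (*-congˡ (sym (sgn*falling≈rising-neg (k ∸ j) (X n) b))))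
                     (solve 5 (λ c s f r g → c :* (s :* f) :* (r :* g) := s :* c :* f :* r :* g) refl
                        (binom k j) (sgn (k ∸ j)) (falling (X n) (k ∸ j) b) (rising (c₀ + c∞) j b) (falling (b * ι j + c₀) n a))

theorem4p9 : {c ℓ : Level} (R : CommutativeRing c ℓ) (n k : ℕ)
    (a b c₀ c∞ : CommutativeRing.Carrier R) →
    let open CommutativeRing R in
    let open GE R in
    (pow b k * fact k * E a b c₀ c∞ n k
      ≈ sumTo k (λ j → sgn (k ∸ j) * binom k j
          * falling (b * ι n + c₀ + c∞) (k ∸ j) b
          * rising (c₀ + c∞) j b
          * falling (b * ι j + c₀) n a))
    × (rising (c₀ + c∞) k b * falling (b * ι k + c₀) n a
      ≈ sumTo k (λ j → binom k j
          * rising (b * ι n + c₀ + c∞) (k ∸ j) b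
          * (pow b j * fact j * E a b c₀ c∞ n j)))
theorem4p9 R n k a b c₀ c∞ = explicit-formula n k , inversion-formula n k
  where open EulerianIdentities R a b c₀ c∞
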